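{- Let $d\ge 3$, let $G$ be a finite simple graph on $[d]$, and let $H_1,\dots,H_m$ be all the connected components of the complement $\overline{G}$ that have at least one edge. Then $$\varepsilon(K_d)-\varepsilon(G)=\sum_{j=1}^m\bigl(\varepsilon(K_d)-\varepsilon(K_d-H_j)\bigr).$$
   Context: For a finite simple graph $G$ on $[d]$ and an edge $e=\{i,j\}$, $\rho(e)=\mathbf{e}_i+\mathbf{e}_j\in\mathbb{R}^d$; the edge polytope $\mathcal{P}_G$ is the convex hull of $\{\rho(e): e\in E(G)\}$, and $\varepsilon(G)$ is the number of its 1-dimensional faces. $K_d$ is the complete graph on $[d]$; $\overline{G}$ is the graph on $[d]$ whose edges are the non-edges of $G$; for a graph $H$ with vertex set contained in $[d]$, $K_d-H$ is the graph on $[d]$ with edge set $E(K_d)\setminus E(H)$. -}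

module Defs where

open import Data.Nat using (ℕ; zero; suc; _≤_)
import Data.Nat as ℕ
open import Data.Fin using (Fin; toℕ; _≟_) renaming (zero to fzero; suc to fsuc)
open import Data.Bool using (Bool; true; false; not; _∧_)
open import Data.Vec using (Vec; lookup)
open import Data.Product using (Σ; _×_; _,_; ∃)
open import Data.Sum using (_⊎_)
open import Data.Integer using (ℤ) renaming (_+_ to _+ℤ_)
import Data.Integer as ℤ
open import Data.Rational using (ℚ) renaming (_+_ to _+ℚ_; _<_ to _<ℚ_)
open import Relation.Nullary using (¬_; does)
open import Relation.Binary.PropositionalEquality using (_≡_)
open import Function.Definitions using (Injective)

Graph : ℕ → Set
Graph d = Fin d → Fin d → Bool

IsSimple : ∀ {d} → Graph d → Set
IsSimple {d} G = (∀ (i j : Fin d) → G i j ≡ G j i) × (∀ (i : Fin d) → G i i ≡ false)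

K : ∀ d → Graph d
K d i j = not (does (i ≟ j))

compl : ∀ {d} → Graph d → Graph d
compl {d} G i j = not (G i j) ∧ K d i j

_∈ₛ_ : ∀ {d} → Fin d → Vec Bool d → Set
x ∈ₛ C = lookup C x ≡ true

data Reach {d} (A : Graph d) (x : Fin d) : Fin d → Set where
  here : Reach A x x
  step : ∀ {y z} → Reach A x y → A y z ≡ true → Reach A x z

IsComponent : ∀ {d} → Graph d → Vec Bool d → Set
IsComponent {d} A C =
  (∃ λ (x : Fin d) → x ∈ₛ C) ×
  (∀ (x y : Fin d) → x ∈ₛ C → ((y ∈ₛ C → Reach A x y) × (Reach A x y → y ∈ₛ C)))

HasEdge : ∀ {d} → Graph d → Vec Bool d → Set
HasEdge {d} A C = Σ (Fin d) λ x → Σ (Fin d) λ y → x ∈ₛ C × y ∈ₛ C × A x y ≡ true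

-- K_d - H, where H is the component of compl G on vertex set C
-- (H has all edges of compl G between vertices of C)
KminusComp : ∀ {d} → Graph d → Vec Bool d → Graph d
KminusComp {d} G C i j = K d i j ∧ not (compl G i j ∧ lookup C i)

LexLt : ∀ {d} → Fin d × Fin d → Fin d × Fin d → Set
LexLt (a , b) (c , e) = (toℕ a ℕ.< toℕ c) ⊎ ((a ≡ c) × (toℕ b ℕ.< toℕ e))

-- the edge {i,j} (i < j) of G, viewed through rho(e) = e_i + e_j ; weight of rho(e) under w
wt : ∀ {d} → (Fin d → ℚ) → Fin d × Fin d → ℚ
wt w (i , j) = w i +ℚ w j

IsEdgeOf : ∀ {d} → Graph d → Fin d × Fin d → Set
IsEdgeOf G (i , j) = (toℕ i ℕ.< toℕ j) × (G i j ≡ true)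

-- An unordered pair {e , f} of distinct edges (listed with e <lex f) such that
-- conv{rho(e), rho(f)} is a 1-dimensional face of the edge polytope P_G:
-- some linear functional w is maximized over the points rho(E(G)) exactly at rho(e), rho(f).
IsPolytopeEdge : ∀ {d} → Graph d → (Fin d × Fin d) × (Fin d × Fin d) → Set
IsPolytopeEdge {d} G (e , f) =
  IsEdgeOf G e × IsEdgeOf G f × LexLt e f ×
  (Σ (Fin d → ℚ) λ w →
     (wt w e ≡ wt w f) ×
     (∀ (g : Fin d × Fin d) → IsEdgeOf G g → ¬ (g ≡ e) → ¬ (g ≡ f) → wt w g <ℚ wt w e))

HasCount : ∀ {A : Set} → (A → Set) → ℕ → Set
HasCount {A} P n =
  Σ (Fin n → A) λ enum →
    Injective _≡_ _≡_ enum × (∀ k → P (enum k)) × (∀ a → P a → ∃ λ k → enum k ≡ a)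

εIs : ∀ {d} → Graph d → ℕ → Set
εIs G n = HasCount (IsPolytopeEdge G) n

sumℤ : ∀ m → (Fin m → ℤ) → ℤ
sumℤ zero f = ℤ.0ℤ
sumℤ (suc m) f = f fzero +ℤ sumℤ m (λ k → f (fsuc k))

{-# OPTIONS --safe #-}
-- By the criterion of Ohsugi and Hibi, two edges e, f of a simple graph A span an edge of the
-- edge polytope P_A iff they share a vertex or do not lie on a common 4-cycle of A; the linear
-- functional exposing that face can be taken integral and supported on the endpoints of e and f.
-- Hence ε(A) counts pairs of edges combinatorially, and the identity can be checked one pair
-- {e, f} at a time.  If e and f share a vertex, the pair counts for K_d, and it fails to count
-- for G, resp. for K_d − H_j, iff e or f is an edge of Ḡ, resp. of H_j; as e ∪ f is connected,
-- this happens for exactly one H_j or for none.  If e and f are disjoint, the pair never counts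
-- for K_d; it counts for G iff e, f ∉ Ḡ and each of the two 4-cycles through e and f has an
-- edge in Ḡ, and any two such edges meet, so the pair counts for exactly one K_d − H_j or none.
module Submission where

open import Defs
open import Data.Nat using (ℕ; zero; suc; _+_; _≤_; _<_; s≤s; z≤n)
import Data.Nat.Properties as ℕP
open import Data.Fin using (Fin; toℕ; _≟_) renaming (zero to fzero; suc to fsuc)
import Data.Fin.Properties as FinP
open FinP using (<⇒≢)
open import Data.Integer using (ℤ; +_; _-_; 0ℤ; 1ℤ) renaming (_+_ to _+ℤ_)
import Data.Integer as ℤ
import Data.Integer.Properties as ℤP
open import Data.Integer.Tactic.RingSolver using (solve-∀)
open import Data.Product using (Σ; _×_; _,_; ∃; proj₁; proj₂)
import Data.Product as Product
open import Data.Sum using (_⊎_; inj₁; inj₂)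
import Data.Sum as Sum
open import Data.Rational using (ℚ; 0ℚ; 1ℚ) renaming (_+_ to _+ℚ_; _<_ to _<ℚ_)
import Data.Rational.Properties as ℚP
open import Data.Bool using (Bool; true; false; not; _∧_)
import Data.Bool as Bool
open import Data.Bool.Properties using (⇔→≡)
open import Data.Empty using (⊥; ⊥-elim)
open import Data.Vec using (Vec)
import Data.Vec as Vec
import Data.Vec.Properties as VecP
open import Data.Vec.Relation.Binary.Pointwise.Extensional using (ext; Pointwise-≡⇒≡)
open import Data.List using (List; []; _∷_; length; lookup; filter; allFin; cartesianProduct)
open import Data.List.Relation.Unary.All using (All; []; _∷_)
import Data.List.Relation.Unary.All as All
open import Data.List.Relation.Unary.Any using (index)
open import Data.List.Relation.Unary.Any.Properties using (lookup-index)
open import Data.List.Relation.Unary.AllPairs using ([]; _∷_)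
open import Data.List.Relation.Unary.Unique.Propositional using (Unique)
import Data.List.Relation.Unary.Unique.Propositional.Properties as UniqueP
open import Data.List.Membership.Propositional using (_∈_)
open import Data.List.Membership.Propositional.Properties
  using (∈-lookup; ∈-filter⁺; ∈-filter⁻; ∈-allFin; ∈-cartesianProduct⁺)
open import Function.Definitions using (Injective)
open import Relation.Unary using (Decidable)
open import Function using (_∘_; id; case_of_; _⇔_; mk⇔; Equivalence)
open import Relation.Binary using (tri<; tri≈; tri>)
open import Algebra.Bundles using (CommutativeMonoid)
open import Algebra.Properties.CommutativeSemigroup
  (CommutativeMonoid.commutativeSemigroup ℚP.+-0-commutativeMonoid)
  using () renaming (interchange to +ℚ-interchange)
open import Relation.Nullary using (¬_; Dec; yes; no; ¬?; does)
open import Relation.Nullary.Decidable using (toSum; decidable-stable; ¬¬-excluded-middle; _⊎-dec_; _×-dec_)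
open import Relation.Binary.PropositionalEquality
  using (_≡_; _≢_; refl; sym; trans; cong; cong₂; subst; subst₂; module ≡-Reasoning)
open ≡-Reasoning
open import Algebra.Properties.CommutativeMonoid.Sum ℤP.+-0-commutativeMonoid
  using (sum-syntax; ∑-comm; sum-cong-≗; sum-replicate-zero)

𝟙 : ∀ {P : Set} → Dec P → ℤ
𝟙 (yes _) = 1ℤ
𝟙 (no _)  = 0ℤ

𝟙-yes : ∀ {P : Set} (p? : Dec P) → P → 𝟙 p? ≡ 1ℤ
𝟙-yes (yes _) _ = refl
𝟙-yes (no ¬p) p = ⊥-elim (¬p p)

𝟙-no : ∀ {P : Set} (p? : Dec P) → ¬ P → 𝟙 p? ≡ 0ℤ
𝟙-no (yes p) ¬p = ⊥-elim (¬p p)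
𝟙-no (no _)  _  = refl

1-𝟙≡𝟙-¬ : ∀ {P : Set} (p? : Dec P) → 1ℤ - 𝟙 p? ≡ 𝟙 (¬? p?)
1-𝟙≡𝟙-¬ (yes _) = refl
1-𝟙≡𝟙-¬ (no _)  = refl

sumℤ≡∑ : ∀ m (f : Fin m → ℤ) → sumℤ m f ≡ ∑[ j < m ] f j
sumℤ≡∑ zero    f = refl
sumℤ≡∑ (suc m) f = cong (f fzero +ℤ_) (sumℤ≡∑ m (λ j → f (fsuc j)))

∑-distrib-- : ∀ n (f g : Fin n → ℤ) → ∑[ i < n ] (f i - g i) ≡ ∑[ i < n ] f i - ∑[ i < n ] g i
∑-distrib-- zero    f g = refl
∑-distrib-- (suc n) f g =
  trans (cong ((f fzero - g fzero) +ℤ_) (∑-distrib-- n (λ i → f (fsuc i)) (λ i → g (fsuc i))))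
        (interchange (f fzero) (g fzero) _ _)
  where
  interchange : ∀ a b c e → (a - b) +ℤ (c - e) ≡ (a +ℤ c) - (b +ℤ e)
  interchange = solve-∀

∑-zero : ∀ n (f : Fin n → ℤ) → (∀ i → f i ≡ 0ℤ) → ∑[ i < n ] f i ≡ 0ℤ
∑-zero n f f≡0 = trans (sum-cong-≗ f≡0) (sum-replicate-zero n)

∑𝟙≡1 : ∀ m {Q : Fin m → Set} (Q? : ∀ j → Dec (Q j)) →
  (∀ j k → Q j → Q k → j ≡ k) → ∀ {j₀} → Q j₀ → ∑[ j < m ] 𝟙 (Q? j) ≡ 1ℤ
∑𝟙≡1 (suc m) Q? Q-unique {fzero} q₀ =
  cong₂ _+ℤ_ (𝟙-yes (Q? fzero) q₀)
    (∑-zero m _ (λ k → 𝟙-no (Q? (fsuc k)) (FinP.0≢1+n ∘ Q-unique _ _ q₀)))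
∑𝟙≡1 (suc m) Q? Q-unique {fsuc j₀} q₀ =
  cong₂ _+ℤ_ (𝟙-no (Q? fzero) (FinP.0≢1+n ∘ sym ∘ Q-unique _ _ q₀))
    (∑𝟙≡1 m (λ k → Q? (fsuc k)) (λ j k qj qk → FinP.suc-injective (Q-unique _ _ qj qk)) q₀)

𝟙≡∑𝟙 : ∀ m {P : Set} {Q : Fin m → Set} (P? : Dec P) (Q? : ∀ j → Dec (Q j)) →
  (P → ∃ Q) → (∀ j → Q j → P) → (∀ j k → Q j → Q k → j ≡ k) →
  𝟙 P? ≡ ∑[ j < m ] 𝟙 (Q? j)
𝟙≡∑𝟙 m (yes p) Q? P⇒∃Q Q⇒P Q-unique = sym (∑𝟙≡1 m Q? Q-unique (proj₂ (P⇒∃Q p)))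
𝟙≡∑𝟙 m (no ¬p) Q? P⇒∃Q Q⇒P Q-unique = sym (∑-zero m _ (λ j → 𝟙-no (Q? j) (λ q → ¬p (Q⇒P j q))))

∑ₗ : ∀ {X : Set} → List X → (X → ℤ) → ℤ
∑ₗ xs f = ∑[ k < length xs ] f (lookup xs k)

lookup-injective : ∀ {X : Set} {xs : List X} → Unique xs → Injective _≡_ _≡_ (lookup xs)
lookup-injective {xs = x ∷ xs} (x∉xs ∷ u) {fzero}  {fzero}  _  = refl
lookup-injective {xs = x ∷ xs} (x∉xs ∷ u) {fzero}  {fsuc j} eq = ⊥-elim (All.lookup x∉xs (∈-lookup j) eq)
lookup-injective {xs = x ∷ xs} (x∉xs ∷ u) {fsuc i} {fzero}  eq = ⊥-elim (All.lookup x∉xs (∈-lookup i) (sym eq))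
lookup-injective {xs = x ∷ xs} (x∉xs ∷ u) {fsuc i} {fsuc j} eq = cong fsuc (lookup-injective u eq)

module _ {X : Set} {P : X → Set} (P? : Decidable P) {xs : List X}
         (unique : Unique xs) (complete : ∀ x → x ∈ xs) where

  count≡length-filter : ∀ {n} → HasCount P n → n ≡ length (filter P? xs)
  count≡length-filter {n} (enum , enum-inj , enum-P , enum-onto) =
    FinP.cantor-schröder-bernstein {f = position} {g = preimage} position-inj preimage-inj
    where
    ys = filter P? xs
    ∈ys : ∀ {x} → P x → x ∈ ys
    ∈ys px = ∈-filter⁺ P? (complete _) px
    position : Fin n → Fin (length ys)
    position k = index (∈ys (enum-P k))
    position-inj : Injective _≡_ _≡_ position
    position-inj {k} {l} eq = enum-inj (begin
      enum k                    ≡⟨ lookup-index (∈ys (enum-P k)) ⟩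
      lookup ys (position k)    ≡⟨ cong (lookup ys) eq ⟩
      lookup ys (position l)    ≡⟨ lookup-index (∈ys (enum-P l)) ⟨
      enum l                    ∎)
    P-lookup : ∀ i → P (lookup ys i)
    P-lookup i = proj₂ (∈-filter⁻ P? {xs = xs} (∈-lookup i))
    preimage : Fin (length ys) → Fin n
    preimage i = proj₁ (enum-onto _ (P-lookup i))
    preimage-inj : Injective _≡_ _≡_ preimage
    preimage-inj {i} {j} eq = lookup-injective (UniqueP.filter⁺ P? unique) (begin
      lookup ys i               ≡⟨ proj₂ (enum-onto _ (P-lookup i)) ⟨
      enum (preimage i)         ≡⟨ cong enum eq ⟩
      enum (preimage j)         ≡⟨ proj₂ (enum-onto _ (P-lookup j)) ⟩
      lookup ys j               ∎)

length-filter≡∑𝟙 : ∀ {X : Set} {P : X → Set} (P? : Decidable P) (xs : List X) →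
  + length (filter P? xs) ≡ ∑ₗ xs (λ x → 𝟙 (P? x))
length-filter≡∑𝟙 P? []       = refl
length-filter≡∑𝟙 P? (x ∷ xs) with P? x
... | yes _ = cong (1ℤ +ℤ_) (length-filter≡∑𝟙 P? xs)
... | no  _ = trans (length-filter≡∑𝟙 P? xs) (sym (ℤP.+-identityˡ _))

HasCount-resp : ∀ {X : Set} {P Q : X → Set} {n} → (∀ x → P x → Q x) → (∀ x → Q x → P x) →
  HasCount P n → HasCount Q n
HasCount-resp P⇒Q Q⇒P (enum , enum-inj , enum-P , enum-onto) =
  enum , enum-inj , (λ k → P⇒Q _ (enum-P k)) , (λ x qx → enum-onto x (Q⇒P x qx))

Symmetric : ∀ {d} → Graph d → Set
Symmetric {d} A = ∀ (i j : Fin d) → A i j ≡ A j i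

Ordered : ∀ {d} → Fin d × Fin d → Set
Ordered (i , j) = toℕ i < toℕ j

LexLt-irrefl : ∀ {d} {e : Fin d × Fin d} → ¬ LexLt e e
LexLt-irrefl (inj₁ a<a)      = ℕP.<-irrefl refl a<a
LexLt-irrefl (inj₂ (_ , b<b)) = ℕP.<-irrefl refl b<b

_∈ₑ_ : ∀ {d} → Fin d → Fin d × Fin d → Set
z ∈ₑ (x , y) = z ≡ x ⊎ z ≡ y

_≐_ : ∀ {d} → Fin d × Fin d → Fin d × Fin d → Set
(i , j) ≐ (x , y) = (i ≡ x × j ≡ y) ⊎ (i ≡ y × j ≡ x)

Share : ∀ {d} → Fin d × Fin d → Fin d × Fin d → Set
Share (a , b) f = a ∈ₑ f ⊎ b ∈ₑ f

_∈ₑ?_ : ∀ {d} (z : Fin d) e → Dec (z ∈ₑ e)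
z ∈ₑ? (x , y) = (z ≟ x) ⊎-dec (z ≟ y)

share? : ∀ {d} (e f : Fin d × Fin d) → Dec (Share e f)
share? (a , b) f = (a ∈ₑ? f) ⊎-dec (b ∈ₑ? f)

shared-endpoint : ∀ {d} {e f : Fin d × Fin d} → Share e f → ∃ λ z → z ∈ₑ e × z ∈ₑ f
shared-endpoint (inj₁ a∈f) = _ , inj₁ refl , a∈f
shared-endpoint (inj₂ b∈f) = _ , inj₂ refl , b∈f

∈ₑ-share : ∀ {d} {z : Fin d} {e f} → z ∈ₑ e → z ∈ₑ f → Share e f
∈ₑ-share (inj₁ refl) z∈f = inj₁ z∈f
∈ₑ-share (inj₂ refl) z∈f = inj₂ z∈f

Share-flip : ∀ {d} {a b : Fin d} {f} → Share (a , b) f → Share (b , a) f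
Share-flip = Sum.swap

Share-sym : ∀ {d} {e f : Fin d × Fin d} → Share e f → Share f e
Share-sym (inj₁ (inj₁ refl)) = inj₁ (inj₁ refl)
Share-sym (inj₁ (inj₂ refl)) = inj₂ (inj₁ refl)
Share-sym (inj₂ (inj₁ refl)) = inj₁ (inj₂ refl)
Share-sym (inj₂ (inj₂ refl)) = inj₂ (inj₂ refl)

≐-sym : ∀ {d} {e f : Fin d × Fin d} → e ≐ f → f ≐ e
≐-sym (inj₁ (refl , refl)) = inj₁ (refl , refl)
≐-sym (inj₂ (refl , refl)) = inj₂ (refl , refl)

≐-trans : ∀ {d} {e f g : Fin d × Fin d} → e ≐ f → f ≐ g → e ≐ g
≐-trans (inj₁ (refl , refl)) f≐g = f≐g
≐-trans (inj₂ (refl , refl)) (inj₁ (refl , refl)) = inj₂ (refl , refl)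
≐-trans (inj₂ (refl , refl)) (inj₂ (refl , refl)) = inj₁ (refl , refl)

≐⇒≡ : ∀ {d} {e f : Fin d × Fin d} → Ordered e → Ordered f → e ≐ f → e ≡ f
≐⇒≡ _   _   (inj₁ (refl , refl)) = refl
≐⇒≡ e<  f<  (inj₂ (refl , refl)) = ⊥-elim (ℕP.<-asym e< f<)

≐⇒∈₁ : ∀ {d} {x y : Fin d} {e} → (x , y) ≐ e → x ∈ₑ e
≐⇒∈₁ (inj₁ (x≡a , _)) = inj₁ x≡a
≐⇒∈₁ (inj₂ (x≡b , _)) = inj₂ x≡b

≐⇒∈₂ : ∀ {d} {x y : Fin d} {e} → (x , y) ≐ e → y ∈ₑ e
≐⇒∈₂ (inj₁ (_ , y≡b)) = inj₂ y≡b
≐⇒∈₂ (inj₂ (_ , y≡a)) = inj₁ y≡a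

-- Sufficiency of the criterion: explicit linear functionals

OnSquare : ∀ {d} → Graph d → Fin d × Fin d → Fin d × Fin d → Set
OnSquare A (a , b) (c , e) = (A a c ≡ true × A b e ≡ true) ⊎ (A a e ≡ true × A b c ≡ true)

IsCombinatorialEdge : ∀ {d} → Graph d → (Fin d × Fin d) × (Fin d × Fin d) → Set
IsCombinatorialEdge A (e , f) =
  IsEdgeOf A e × IsEdgeOf A f × LexLt e f × (Share e f ⊎ ¬ OnSquare A e f)

FaceWitness : ∀ {d} → Graph d → Fin d × Fin d → Fin d × Fin d → Set
FaceWitness {d} A e f = Σ (Fin d → ℚ) λ w →
  (wt w e ≡ wt w f) × (∀ g → IsEdgeOf A g → ¬ g ≡ e → ¬ g ≡ f → wt w g <ℚ wt w e)

fromℕ : ℕ → ℚ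
fromℕ zero    = 0ℚ
fromℕ (suc n) = 1ℚ +ℚ fromℕ n

fromℕ-+ : ∀ m n → fromℕ (m + n) ≡ fromℕ m +ℚ fromℕ n
fromℕ-+ zero    n = sym (ℚP.+-identityˡ (fromℕ n))
fromℕ-+ (suc m) n = trans (cong (1ℚ +ℚ_) (fromℕ-+ m n)) (sym (ℚP.+-assoc 1ℚ (fromℕ m) (fromℕ n)))

fromℕ-<-suc : ∀ n → fromℕ n <ℚ fromℕ (suc n)
fromℕ-<-suc n =
  subst (_<ℚ 1ℚ +ℚ fromℕ n) (ℚP.+-identityˡ (fromℕ n)) (ℚP.+-monoˡ-< (fromℕ n) (ℚP.positive⁻¹ 1ℚ))

fromℕ-mono-< : ∀ {m n} → m < n → fromℕ m <ℚ fromℕ n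
fromℕ-mono-< {m} {suc n} (s≤s m≤n) with ℕP.m≤n⇒m<n∨m≡n m≤n
... | inj₁ m<n  = ℚP.<-trans (fromℕ-mono-< m<n) (fromℕ-<-suc n)
... | inj₂ refl = fromℕ-<-suc n

wtℕ : ∀ {d} → (Fin d → ℕ) → Fin d × Fin d → ℕ
wtℕ ν (i , j) = ν i + ν j

wtℕ-≐ : ∀ {d} (ν : Fin d → ℕ) {e f} → e ≐ f → wtℕ ν e ≡ wtℕ ν f
wtℕ-≐ ν (inj₁ (refl , refl)) = refl
wtℕ-≐ ν (inj₂ (refl , refl)) = ℕP.+-comm (ν _) (ν _)

faceWitness-swap : ∀ {d} {A : Graph d} {e f} → FaceWitness A e f → FaceWitness A f e
faceWitness-swap (w , e≡f , below) =
  w , sym e≡f , λ g g∈A g≢f g≢e → subst (wt w g <ℚ_) e≡f (below g g∈A g≢e g≢f)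

faceWitness-fromℕ : ∀ {d} (A : Graph d) (ν : Fin d → ℕ) (T : ℕ) {e f p q} →
  Ordered e → Ordered f → e ≐ p → f ≐ q → wtℕ ν p ≡ T → wtℕ ν q ≡ T →
  (∀ i j → i ≢ j → A i j ≡ true → ¬ (i , j) ≐ p → ¬ (i , j) ≐ q → ν i + ν j < T) →
  FaceWitness A e f
faceWitness-fromℕ A ν T {e} {f} e< f< e≐p f≐q p≡T q≡T below-T =
  fromℕ ∘ ν , trans (wt≡ e) (trans (cong fromℕ (trans e≡T (sym f≡T))) (sym (wt≡ f))) , below
  where
  wt≡ : ∀ g → wt (fromℕ ∘ ν) g ≡ fromℕ (wtℕ ν g)
  wt≡ (i , j) = sym (fromℕ-+ (ν i) (ν j))
  e≡T = trans (wtℕ-≐ ν e≐p) p≡T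
  f≡T = trans (wtℕ-≐ ν f≐q) q≡T
  below : ∀ g → IsEdgeOf A g → ¬ g ≡ e → ¬ g ≡ f → wt (fromℕ ∘ ν) g <ℚ wt (fromℕ ∘ ν) e
  below g@(i , j) (i<j , Aij) g≢e g≢f = subst₂ _<ℚ_ (sym (wt≡ g)) (trans (cong fromℕ (sym e≡T)) (sym (wt≡ e)))
    (fromℕ-mono-< (below-T i j (<⇒≢ i<j) Aij
      (λ g≐p → g≢e (≐⇒≡ i<j e< (≐-trans g≐p (≐-sym e≐p))))
      (λ g≐q → g≢f (≐⇒≡ i<j f< (≐-trans g≐q (≐-sym f≐q))))))

vertexWeights : ∀ {d} → List (Fin d × ℕ) → Fin d → ℕ
vertexWeights []               z = 0
vertexWeights ((u , k) ∷ rest) z with z ≟ u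
... | yes _ = k
... | no  _ = vertexWeights rest z

vertexWeights-hit : ∀ {d} (u : Fin d) {k} rest → vertexWeights ((u , k) ∷ rest) u ≡ k
vertexWeights-hit u rest with u ≟ u
... | yes _   = refl
... | no  u≢u = ⊥-elim (u≢u refl)

vertexWeights-miss : ∀ {d} {z : Fin d} u {k} rest → z ≢ u →
  vertexWeights ((u , k) ∷ rest) z ≡ vertexWeights rest z
vertexWeights-miss {z = z} u rest z≢u with z ≟ u
... | yes z≡u = ⊥-elim (z≢u z≡u)
... | no  _   = refl

vertexWeights-≤ : ∀ {d} {M} (rest : List (Fin d × ℕ)) → All (λ uk → proj₂ uk ≤ M) rest →
  ∀ z → vertexWeights rest z ≤ M
vertexWeights-≤ []               []         z = z≤n
vertexWeights-≤ ((u , k) ∷ rest) (k≤M ∷ ≤M) z with z ≟ u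
... | yes _ = k≤M
... | no  _ = vertexWeights-≤ rest ≤M z

+-<-suc : ∀ {m n a b} → m ≤ a → n ≤ b → m + n < suc (a + b)
+-<-suc m≤a n≤b = s≤s (ℕP.+-mono-≤ m≤a n≤b)

module _ {d} (A : Graph d) {v x y : Fin d} (v≢x : v ≢ x) (v≢y : v ≢ y) (x≢y : x ≢ y) where

  private
    -- Every edge other than vx and vy has weight at most 2.
    ν : Fin d → ℕ
    ν = vertexWeights ((v , 2) ∷ (x , 1) ∷ (y , 1) ∷ [])

    ν-v : ν v ≡ 2
    ν-v = vertexWeights-hit v _
    ν-x : ν x ≡ 1
    ν-x = trans (vertexWeights-miss v _ (v≢x ∘ sym)) (vertexWeights-hit x _)
    ν-y : ν y ≡ 1
    ν-y = trans (vertexWeights-miss v _ (v≢y ∘ sym))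
          (trans (vertexWeights-miss x _ (x≢y ∘ sym)) (vertexWeights-hit y _))
    ν-other : ∀ {z} → z ≢ v → z ≢ x → z ≢ y → ν z ≡ 0
    ν-other z≢v z≢x z≢y =
      trans (vertexWeights-miss v _ z≢v) (trans (vertexWeights-miss x _ z≢x) (vertexWeights-miss y _ z≢y))
    ν-≤1 : ∀ {z} → z ≢ v → ν z ≤ 1
    ν-≤1 {z} z≢v = subst (_≤ 1) (sym (vertexWeights-miss v _ z≢v))
      (vertexWeights-≤ _ (ℕP.≤-refl ∷ ℕP.≤-refl ∷ []) z)

    spoke : ∀ {z} → z ≢ v → z ≢ x → z ≢ y → ν v + ν z < 3
    spoke z≢v z≢x z≢y = +-<-suc (ℕP.≤-reflexive ν-v) (ℕP.≤-reflexive (ν-other z≢v z≢x z≢y))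

    below : ∀ i j → i ≢ j → ¬ (i , j) ≐ (v , x) → ¬ (i , j) ≐ (v , y) → ν i + ν j < 3
    below i j i≢j ≢vx ≢vy with toSum (i ≟ v) | toSum (j ≟ v)
    ... | inj₁ refl | _ = spoke (i≢j ∘ sym) (λ j≡x → ≢vx (inj₁ (refl , j≡x))) (λ j≡y → ≢vy (inj₁ (refl , j≡y)))
    ... | inj₂ i≢v | inj₁ refl = subst (_< 3) (ℕP.+-comm (ν v) (ν i))
      (spoke i≢v (λ i≡x → ≢vx (inj₂ (i≡x , refl))) (λ i≡y → ≢vy (inj₂ (i≡y , refl))))
    ... | inj₂ i≢v | inj₂ j≢v = +-<-suc (ν-≤1 i≢v) (ν-≤1 j≢v)

  sharedVertexWitness : ∀ {e f} → Ordered e → Ordered f → e ≐ (v , x) → f ≐ (v , y) → FaceWitness A e f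
  sharedVertexWitness e< f< e≐vx f≐vy = faceWitness-fromℕ A ν 3 e< f< e≐vx f≐vy
    (cong₂ _+_ ν-v ν-x) (cong₂ _+_ ν-v ν-y) (λ i j i≢j _ → below i j i≢j)

Misses : ∀ {d} → Graph d → Fin d → Fin d × Fin d → Set
Misses A z (x , y) = ¬ A z x ≡ true × ¬ A z y ≡ true

module _ {d} {A : Graph d} (A-sym : Symmetric A) {v p o₁ o₂ : Fin d}
         (v≢p : v ≢ p) (o₁≢o₂ : o₁ ≢ o₂) (disjoint : ¬ Share (v , p) (o₁ , o₂))
         (p-misses : Misses A p (o₁ , o₂)) where

  private
    v≢o₁ : v ≢ o₁
    v≢o₁ = disjoint ∘ inj₁ ∘ inj₁
    v≢o₂ : v ≢ o₂
    v≢o₂ = disjoint ∘ inj₁ ∘ inj₂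
    p≢o₁ : p ≢ o₁
    p≢o₁ = disjoint ∘ inj₂ ∘ inj₁
    p≢o₂ : p ≢ o₂
    p≢o₂ = disjoint ∘ inj₂ ∘ inj₂

    -- Only vp and o₁o₂ reach weight 4: any other edge at p ends outside {v, o₁, o₂}.
    ν : Fin d → ℕ
    ν = vertexWeights ((p , 3) ∷ (o₁ , 2) ∷ (o₂ , 2) ∷ (v , 1) ∷ [])

    ν-p : ν p ≡ 3
    ν-p = vertexWeights-hit p _
    ν-o₁ : ν o₁ ≡ 2
    ν-o₁ = trans (vertexWeights-miss p _ (p≢o₁ ∘ sym)) (vertexWeights-hit o₁ _)
    ν-o₂ : ν o₂ ≡ 2
    ν-o₂ = trans (vertexWeights-miss p _ (p≢o₂ ∘ sym))
          (trans (vertexWeights-miss o₁ _ (o₁≢o₂ ∘ sym)) (vertexWeights-hit o₂ _))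
    ν-v : ν v ≡ 1
    ν-v = trans (vertexWeights-miss p _ v≢p) (trans (vertexWeights-miss o₁ _ v≢o₁)
          (trans (vertexWeights-miss o₂ _ v≢o₂) (vertexWeights-hit v _)))
    ν-other : ∀ {z} → z ≢ p → z ≢ o₁ → z ≢ o₂ → z ≢ v → ν z ≡ 0
    ν-other z≢p z≢o₁ z≢o₂ z≢v = trans (vertexWeights-miss p _ z≢p) (trans (vertexWeights-miss o₁ _ z≢o₁)
          (trans (vertexWeights-miss o₂ _ z≢o₂) (vertexWeights-miss v _ z≢v)))
    ν-≤2 : ∀ {z} → z ≢ p → ν z ≤ 2
    ν-≤2 {z} z≢p = subst (_≤ 2) (sym (vertexWeights-miss p _ z≢p))
      (vertexWeights-≤ _ (ℕP.≤-refl ∷ ℕP.≤-refl ∷ ℕP.n≤1+n 1 ∷ []) z)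
    ν-≤1 : ∀ {z} → z ≢ p → z ≢ o₁ → z ≢ o₂ → ν z ≤ 1
    ν-≤1 {z} z≢p z≢o₁ z≢o₂ = subst (_≤ 1)
      (sym (trans (vertexWeights-miss p _ z≢p)
             (trans (vertexWeights-miss o₁ _ z≢o₁) (vertexWeights-miss o₂ _ z≢o₂))))
      (vertexWeights-≤ _ (ℕP.≤-refl ∷ []) z)

    from-p : ∀ {z} → z ≢ p → z ≢ v → A p z ≡ true → ν p + ν z < 4
    from-p z≢p z≢v Apz = +-<-suc (ℕP.≤-reflexive ν-p) (ℕP.≤-reflexive
      (ν-other z≢p (λ { refl → proj₁ p-misses Apz }) (λ { refl → proj₂ p-misses Apz }) z≢v))

    away-from-p : ∀ i j → i ≢ j → i ≢ p → j ≢ p → ¬ (i , j) ≐ (o₁ , o₂) → ν i + ν j < 4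
    away-from-p i j i≢j i≢p j≢p ≢o₁o₂ with toSum (i ≟ o₁) | toSum (i ≟ o₂)
    ... | inj₁ refl | _ = +-<-suc (ℕP.≤-reflexive ν-o₁)
      (ν-≤1 j≢p (i≢j ∘ sym) (λ j≡o₂ → ≢o₁o₂ (inj₁ (refl , j≡o₂))))
    ... | inj₂ _ | inj₁ refl = +-<-suc (ℕP.≤-reflexive ν-o₂)
      (ν-≤1 j≢p (λ j≡o₁ → ≢o₁o₂ (inj₂ (refl , j≡o₁))) (i≢j ∘ sym))
    ... | inj₂ i≢o₁ | inj₂ i≢o₂ = +-<-suc (ν-≤1 i≢p i≢o₁ i≢o₂) (ν-≤2 j≢p)

    below : ∀ i j → i ≢ j → A i j ≡ true → ¬ (i , j) ≐ (v , p) → ¬ (i , j) ≐ (o₁ , o₂) → ν i + ν j < 4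
    below i j i≢j Aij ≢vp ≢o₁o₂ with toSum (i ≟ p) | toSum (j ≟ p)
    ... | inj₁ refl | _ = from-p (i≢j ∘ sym) (λ j≡v → ≢vp (inj₂ (refl , j≡v))) Aij
    ... | inj₂ i≢p | inj₁ refl = subst (_< 4) (ℕP.+-comm (ν p) (ν i))
      (from-p i≢p (λ i≡v → ≢vp (inj₁ (i≡v , refl))) (trans (A-sym p i) Aij))
    ... | inj₂ i≢p | inj₂ j≢p = away-from-p i j i≢j i≢p j≢p ≢o₁o₂

  disjointWitness : ∀ {e f} → Ordered e → Ordered f → e ≐ (v , p) → f ≐ (o₁ , o₂) → FaceWitness A e f
  disjointWitness e< f< e≐vp f≐o₁o₂ = faceWitness-fromℕ A ν 4 e< f< e≐vp f≐o₁o₂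
    (cong₂ _+_ ν-v ν-p) (cong₂ _+_ ν-o₁ ν-o₂) below

¬square⇒miss : ∀ ac ae bc be → ¬ ((ac ≡ true × be ≡ true) ⊎ (ae ≡ true × bc ≡ true)) →
  (ac ≢ true × ae ≢ true) ⊎ (bc ≢ true × be ≢ true) ⊎ (ac ≢ true × bc ≢ true) ⊎ (ae ≢ true × be ≢ true)
¬square⇒miss false false _     _     _     = inj₁ ((λ ()) , (λ ()))
¬square⇒miss false true  false _     _     = inj₂ (inj₂ (inj₁ ((λ ()) , (λ ()))))
¬square⇒miss true  false _     false _     = inj₂ (inj₂ (inj₂ ((λ ()) , (λ ()))))
¬square⇒miss true  true  false false _     = inj₂ (inj₁ ((λ ()) , (λ ())))
¬square⇒miss _     true  true  _     ¬sq = ⊥-elim (¬sq (inj₂ (refl , refl)))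
¬square⇒miss true  _     _     true  ¬sq = ⊥-elim (¬sq (inj₁ (refl , refl)))

non-edge-sym : ∀ {d} {A : Graph d} → Symmetric A → ∀ {x y} → A x y ≢ true → A y x ≢ true
non-edge-sym A-sym {x} {y} ¬xy = ¬xy ∘ trans (A-sym x y)

¬onSquare⇒misses : ∀ {d} {A : Graph d} → Symmetric A → ∀ {a b c e} → ¬ OnSquare A (a , b) (c , e) →
  Misses A a (c , e) ⊎ Misses A b (c , e) ⊎ Misses A c (a , b) ⊎ Misses A e (a , b)
¬onSquare⇒misses {A = A} A-sym {a} {b} {c} {e} ¬sq with ¬square⇒miss (A a c) (A a e) (A b c) (A b e) ¬sq
... | inj₁ a-misses                  = inj₁ a-misses
... | inj₂ (inj₁ b-misses)           = inj₂ (inj₁ b-misses)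
... | inj₂ (inj₂ (inj₁ (¬ac , ¬bc))) = inj₂ (inj₂ (inj₁ (non-edge-sym A-sym ¬ac , non-edge-sym A-sym ¬bc)))
... | inj₂ (inj₂ (inj₂ (¬ae , ¬be))) = inj₂ (inj₂ (inj₂ (non-edge-sym A-sym ¬ae , non-edge-sym A-sym ¬be)))

module _ {d} {A : Graph d} (A-sym : Symmetric A) {a b c e : Fin d}
         (a<b : Ordered (a , b)) (c<e : Ordered (c , e)) (lex : LexLt (a , b) (c , e)) where

  shareWitness : Share (a , b) (c , e) → FaceWitness A (a , b) (c , e)
  shareWitness (inj₁ (inj₁ refl)) = sharedVertexWitness A (<⇒≢ a<b) (<⇒≢ c<e) (λ { refl → LexLt-irrefl lex })
    a<b c<e (inj₁ (refl , refl)) (inj₁ (refl , refl))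
  shareWitness (inj₁ (inj₂ refl)) = sharedVertexWitness A (<⇒≢ a<b) (<⇒≢ c<e ∘ sym) (λ { refl → ℕP.<-asym a<b c<e })
    a<b c<e (inj₁ (refl , refl)) (inj₂ (refl , refl))
  shareWitness (inj₂ (inj₁ refl)) = sharedVertexWitness A (<⇒≢ a<b ∘ sym) (<⇒≢ c<e) (λ { refl → ℕP.<-asym a<b c<e })
    a<b c<e (inj₂ (refl , refl)) (inj₁ (refl , refl))
  shareWitness (inj₂ (inj₂ refl)) =
    sharedVertexWitness A (<⇒≢ a<b ∘ sym) (<⇒≢ c<e ∘ sym) (λ { refl → LexLt-irrefl lex })
    a<b c<e (inj₂ (refl , refl)) (inj₂ (refl , refl))

  disjointEdgesWitness : ¬ Share (a , b) (c , e) → ¬ OnSquare A (a , b) (c , e) → FaceWitness A (a , b) (c , e)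
  disjointEdgesWitness ¬share ¬sq with ¬onSquare⇒misses A-sym ¬sq
  ... | inj₁ a-misses = disjointWitness A-sym (<⇒≢ a<b ∘ sym) (<⇒≢ c<e) (¬share ∘ Share-flip) a-misses
    a<b c<e (inj₂ (refl , refl)) (inj₁ (refl , refl))
  ... | inj₂ (inj₁ b-misses) = disjointWitness A-sym (<⇒≢ a<b) (<⇒≢ c<e) ¬share b-misses
    a<b c<e (inj₁ (refl , refl)) (inj₁ (refl , refl))
  ... | inj₂ (inj₂ (inj₁ c-misses)) = faceWitness-swap (disjointWitness A-sym (<⇒≢ c<e ∘ sym) (<⇒≢ a<b)
    (¬share ∘ Share-sym ∘ Share-flip) c-misses c<e a<b (inj₂ (refl , refl)) (inj₁ (refl , refl)))
  ... | inj₂ (inj₂ (inj₂ e-misses)) = faceWitness-swap (disjointWitness A-sym (<⇒≢ c<e) (<⇒≢ a<b)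
    (¬share ∘ Share-sym) e-misses c<e a<b (inj₁ (refl , refl)) (inj₁ (refl , refl)))

  criterion⇒faceWitness : Share (a , b) (c , e) ⊎ ¬ OnSquare A (a , b) (c , e) → FaceWitness A (a , b) (c , e)
  criterion⇒faceWitness criterion with share? (a , b) (c , e)
  ... | yes share = shareWitness share
  ... | no ¬share = disjointEdgesWitness ¬share (Sum.[ ⊥-elim ∘ ¬share , id ]′ criterion)

combinatorialEdge⇒polytopeEdge : ∀ {d} {A : Graph d} → Symmetric A →
  ∀ t → IsCombinatorialEdge A t → IsPolytopeEdge A t
combinatorialEdge⇒polytopeEdge A-sym _ (ab@(a<b , _) , ce@(c<e , _) , lex , criterion) =
  ab , ce , lex , criterion⇒faceWitness A-sym a<b c<e lex criterion

-- Necessity of the criterion, and counting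

module _ {d} {A : Graph d} (A-sym : Symmetric A) where

  faceWitness-below : ∀ {e f} ((w , _) : FaceWitness A e f) → ∀ {x y} → x ≢ y → A x y ≡ true →
    ¬ (x , y) ≐ e → ¬ (x , y) ≐ f → wt w (x , y) <ℚ wt w e
  faceWitness-below {e} (w , _ , below) {x} {y} x≢y Axy ≭e ≭f with FinP.<-cmp x y
  ... | tri< x<y _ _ = below (x , y) (x<y , Axy)
    (λ { refl → ≭e (inj₁ (refl , refl)) }) (λ { refl → ≭f (inj₁ (refl , refl)) })
  ... | tri≈ _ x≡y _ = ⊥-elim (x≢y x≡y)
  ... | tri> _ _ y<x = subst (_<ℚ wt w e) (ℚP.+-comm (w y) (w x)) (below (y , x) (y<x , trans (A-sym y x) Axy)
    (λ { refl → ≭e (inj₂ (refl , refl)) }) (λ { refl → ≭f (inj₂ (refl , refl)) }))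

  -- The cross edges differ from e and f, so their weights add up to less than twice that of e,
  -- yet they cover the same four vertices as e and f, whose weights add up to exactly that.
  faceWitness⇒¬onSquare : ∀ {a b c e} → FaceWitness A (a , b) (c , e) →
    ¬ Share (a , b) (c , e) → ¬ OnSquare A (a , b) (c , e)
  faceWitness⇒¬onSquare {a} {b} {c} {e} W@(w , wt≡ , _) ¬share = λ
    { (inj₁ (Aac , Abe)) → ℚP.<-irrefl (trans (+ℚ-interchange (w a) (w c) (w b) (w e))
        (cong (W₀ +ℚ_) (sym wt≡)))
        (ℚP.+-mono-< (cross (inj₁ refl) (inj₁ refl) Aac) (cross (inj₂ refl) (inj₂ refl) Abe))
    ; (inj₂ (Aae , Abc)) → ℚP.<-irrefl (trans (+ℚ-interchange (w a) (w e) (w b) (w c))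
        (cong (W₀ +ℚ_) (trans (ℚP.+-comm (w e) (w c)) (sym wt≡))))
        (ℚP.+-mono-< (cross (inj₁ refl) (inj₂ refl) Aae) (cross (inj₂ refl) (inj₁ refl) Abc))
    }
    where
    W₀ = w a +ℚ w b
    cross : ∀ {x y} → x ∈ₑ (a , b) → y ∈ₑ (c , e) → A x y ≡ true → w x +ℚ w y <ℚ W₀
    cross x∈ab y∈ce Axy = faceWitness-below W (λ { refl → ¬share (∈ₑ-share x∈ab y∈ce) }) Axy
      (λ ≐ab → ¬share (∈ₑ-share (≐⇒∈₂ ≐ab) y∈ce)) (λ ≐ce → ¬share (∈ₑ-share x∈ab (≐⇒∈₁ ≐ce)))

  polytopeEdge⇒combinatorialEdge : ∀ t → IsPolytopeEdge A t → IsCombinatorialEdge A t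
  polytopeEdge⇒combinatorialEdge (e , f) (e∈A , f∈A , lex , W) with share? e f
  ... | yes share = e∈A , f∈A , lex , inj₁ share
  ... | no ¬share = e∈A , f∈A , lex , inj₂ (faceWitness⇒¬onSquare W ¬share)

isEdgeOf? : ∀ {d} (A : Graph d) g → Dec (IsEdgeOf A g)
isEdgeOf? A (i , j) = (toℕ i ℕP.<? toℕ j) ×-dec (A i j Bool.≟ true)

lexLt? : ∀ {d} (e f : Fin d × Fin d) → Dec (LexLt e f)
lexLt? (a , b) (c , e) = (toℕ a ℕP.<? toℕ c) ⊎-dec ((a ≟ c) ×-dec (toℕ b ℕP.<? toℕ e))

onSquare? : ∀ {d} (A : Graph d) e f → Dec (OnSquare A e f)
onSquare? A (a , b) (c , e) =
  ((A a c Bool.≟ true) ×-dec (A b e Bool.≟ true)) ⊎-dec ((A a e Bool.≟ true) ×-dec (A b c Bool.≟ true))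

isCombinatorialEdge? : ∀ {d} (A : Graph d) t → Dec (IsCombinatorialEdge A t)
isCombinatorialEdge? A (e , f) =
  isEdgeOf? A e ×-dec isEdgeOf? A f ×-dec lexLt? e f ×-dec (share? e f ⊎-dec ¬? (onSquare? A e f))

χ : ∀ {d} → Graph d → (Fin d × Fin d) × (Fin d × Fin d) → ℤ
χ A t = 𝟙 (isCombinatorialEdge? A t)

quadruples : ∀ d → List ((Fin d × Fin d) × (Fin d × Fin d))
quadruples d = cartesianProduct pairs pairs
  where pairs = cartesianProduct (allFin d) (allFin d)

quadruples-unique : ∀ d → Unique (quadruples d)
quadruples-unique d = UniqueP.cartesianProduct⁺ pairs-unique pairs-unique
  where pairs-unique = UniqueP.cartesianProduct⁺ (UniqueP.allFin⁺ d) (UniqueP.allFin⁺ d)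

∈-quadruples : ∀ {d} t → t ∈ quadruples d
∈-quadruples ((a , b) , (c , e)) =
  ∈-cartesianProduct⁺ (∈-cartesianProduct⁺ (∈-allFin a) (∈-allFin b))
                      (∈-cartesianProduct⁺ (∈-allFin c) (∈-allFin e))

ε≡∑χ : ∀ {d} {A : Graph d} → Symmetric A → ∀ {n} → εIs A n →
  + n ≡ ∑ₗ (quadruples d) (χ A)
ε≡∑χ {d} {A} A-sym {n} ε = begin
  + n                                          ≡⟨ cong +_ (count≡length-filter (isCombinatorialEdge? A)
                                                             (quadruples-unique d) ∈-quadruples counts) ⟩
  + length (filter (isCombinatorialEdge? A) Q) ≡⟨ length-filter≡∑𝟙 (isCombinatorialEdge? A) Q ⟩
  ∑ₗ Q (χ A)                                   ∎
  where
  Q = quadruples d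
  counts : HasCount (IsCombinatorialEdge A) n
  counts = HasCount-resp (polytopeEdge⇒combinatorialEdge A-sym) (combinatorialEdge⇒polytopeEdge A-sym) ε

IsCompleteMinus : ∀ {d} → Graph d → (Fin d → Fin d → Set) → Set
IsCompleteMinus {d} A R = ∀ {x y : Fin d} → x ≢ y → A x y ≡ true ⇔ (¬ R x y)

completeMinus-sym : ∀ {d} {A : Graph d} {R} → IsCompleteMinus A R → (∀ {x y} → R x y → R y x) → Symmetric A
completeMinus-sym {A = A} A≈ R-sym x y with x ≟ y
... | yes refl = refl
... | no  x≢y  = ⇔→≡ (mk⇔ (flip x≢y) (flip (x≢y ∘ sym)))
  where
  flip : ∀ {x y} → x ≢ y → A x y ≡ true → A y x ≡ true
  flip x≢y Axy = Equivalence.from (A≈ (x≢y ∘ sym)) (Equivalence.to (A≈ x≢y) Axy ∘ R-sym)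

¬[¬×¬]⇒⊎ : ∀ {X Y : Set} → Dec X → Dec Y → ¬ (¬ X × ¬ Y) → X ⊎ Y
¬[¬×¬]⇒⊎ (yes x) _       _ = inj₁ x
¬[¬×¬]⇒⊎ (no ¬x) (yes y) _ = inj₂ y
¬[¬×¬]⇒⊎ (no ¬x) (no ¬y) ¬both = ⊥-elim (¬both (¬x , ¬y))

module _ {d} {A : Graph d} {R : Fin d → Fin d → Set} (R? : ∀ x y → Dec (R x y)) (A≈ : IsCompleteMinus A R)
         {a b c e : Fin d} (a<b : Ordered (a , b)) (c<e : Ordered (c , e)) (lex : LexLt (a , b) (c , e)) where

  private
    keep : ∀ {x y} → x ≢ y → ¬ R x y → A x y ≡ true
    keep x≢y = Equivalence.from (A≈ x≢y)
    kept : ∀ {x y} → x ≢ y → A x y ≡ true → ¬ R x y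
    kept x≢y = Equivalence.to (A≈ x≢y)
    a≢b = <⇒≢ a<b
    c≢e = <⇒≢ c<e

  ¬combinatorialEdge⇔-share : Share (a , b) (c , e) →
    (¬ IsCombinatorialEdge A ((a , b) , (c , e))) ⇔ (R a b ⊎ R c e)
  ¬combinatorialEdge⇔-share share = mk⇔
    (λ ¬comb → ¬[¬×¬]⇒⊎ (R? a b) (R? c e) λ (¬Rab , ¬Rce) →
       ¬comb ((a<b , keep a≢b ¬Rab) , (c<e , keep c≢e ¬Rce) , lex , inj₁ share))
    (λ { (inj₁ Rab) ((_ , Aab) , _) → kept a≢b Aab Rab
       ; (inj₂ Rce) (_ , (_ , Ace) , _) → kept c≢e Ace Rce })

  combinatorialEdge⇔-disjoint : ¬ Share (a , b) (c , e) →
    IsCombinatorialEdge A ((a , b) , (c , e)) ⇔ (¬ R a b × ¬ R c e × (R a c ⊎ R b e) × (R a e ⊎ R b c))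
  combinatorialEdge⇔-disjoint ¬share = mk⇔
    (λ { ((_ , Aab) , (_ , Ace) , _ , inj₁ share) → ⊥-elim (¬share share)
       ; ((_ , Aab) , (_ , Ace) , _ , inj₂ ¬sq) →
           kept a≢b Aab , kept c≢e Ace ,
           ¬[¬×¬]⇒⊎ (R? a c) (R? b e) (λ (¬Rac , ¬Rbe) → ¬sq (inj₁ (keep a≢c ¬Rac , keep b≢e ¬Rbe))) ,
           ¬[¬×¬]⇒⊎ (R? a e) (R? b c) (λ (¬Rae , ¬Rbc) → ¬sq (inj₂ (keep a≢e ¬Rae , keep b≢c ¬Rbc))) })
    (λ (¬Rab , ¬Rce , Rac⊎Rbe , Rae⊎Rbc) →
       (a<b , keep a≢b ¬Rab) , (c<e , keep c≢e ¬Rce) , lex , inj₂ λ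
         { (inj₁ (Aac , Abe)) → Sum.[ kept a≢c Aac , kept b≢e Abe ]′ Rac⊎Rbe
         ; (inj₂ (Aae , Abc)) → Sum.[ kept a≢e Aae , kept b≢c Abc ]′ Rae⊎Rbc })
    where
    a≢c = ¬share ∘ inj₁ ∘ inj₁
    a≢e = ¬share ∘ inj₁ ∘ inj₂
    b≢c = ¬share ∘ inj₂ ∘ inj₁
    b≢e = ¬share ∘ inj₂ ∘ inj₂

K-≢ : ∀ {d} {x y : Fin d} → x ≢ y → K d x y ≡ true
K-≢ {x = x} {y} x≢y with x ≟ y
... | yes x≡y = ⊥-elim (x≢y x≡y)
... | no  _   = refl

K-minus-⊥ : ∀ {d} → IsCompleteMinus (K d) (λ _ _ → ⊥)
K-minus-⊥ x≢y = mk⇔ (λ _ ()) (λ _ → K-≢ x≢y)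

K-sym : ∀ {d} → Symmetric (K d)
K-sym = completeMinus-sym K-minus-⊥ id

compl-sym : ∀ {d} {G : Graph d} → Symmetric G → Symmetric (compl G)
compl-sym G-sym i j = cong₂ _∧_ (cong not (G-sym i j)) (K-sym i j)

minus-compl : ∀ {d} (G : Graph d) → IsCompleteMinus G (λ x y → compl G x y ≡ true)
minus-compl {d} G {x} {y} x≢y = lemma (G x y) (K d x y) (K-≢ x≢y)
  where
  lemma : ∀ g k → k ≡ true → g ≡ true ⇔ (¬ (not g ∧ k) ≡ true)
  lemma true  true refl = mk⇔ (λ _ ()) (λ _ → refl)
  lemma false true refl = mk⇔ (λ ()) (λ ¬true → ⊥-elim (¬true refl))

-- Connected components of the complement

Reach-trans : ∀ {d} {A : Graph d} {x y z} → Reach A x y → Reach A y z → Reach A x z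
Reach-trans x⇝y here           = x⇝y
Reach-trans x⇝y (step y⇝z Azw) = step (Reach-trans x⇝y y⇝z) Azw

Reach-sym : ∀ {d} {A : Graph d} → Symmetric A → ∀ {x y} → Reach A x y → Reach A y x
Reach-sym A-sym here                   = here
Reach-sym A-sym (step {y} {z} x⇝y Ayz) = Reach-trans (step here (trans (A-sym z y) Ayz)) (Reach-sym A-sym x⇝y)

module _ {d} {A : Graph d} {x : Fin d} (reach? : ∀ y → Dec (Reach A x y)) where

  componentOf : Vec Bool d
  componentOf = Vec.tabulate (λ y → does (reach? y))

  ∈-componentOf : ∀ {y} → y ∈ₛ componentOf ⇔ Reach A x y
  ∈-componentOf {y} =
    subst (λ b → b ≡ true ⇔ Reach A x y) (sym (VecP.lookup∘tabulate _ y)) (does⇔ (reach? y))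
    where
    does⇔ : ∀ {P : Set} (p? : Dec P) → does p? ≡ true ⇔ P
    does⇔ (yes p) = mk⇔ (λ _ → p) (λ _ → refl)
    does⇔ (no ¬p) = mk⇔ (λ ()) (⊥-elim ∘ ¬p)

  componentOf-isComponent : Symmetric A → IsComponent A componentOf
  componentOf-isComponent A-sym = (x , from here) , λ u v u∈ →
    (λ v∈ → Reach-trans (Reach-sym A-sym (to u∈)) (to v∈)) , (λ u⇝v → from (Reach-trans (to u∈) u⇝v))
    where
    to : ∀ {y} → y ∈ₛ componentOf → Reach A x y
    to = Equivalence.to ∈-componentOf
    from : ∀ {y} → Reach A x y → y ∈ₛ componentOf
    from = Equivalence.from ∈-componentOf

  componentOf-hasEdge : ∀ {y} → A x y ≡ true → HasEdge A componentOf
  componentOf-hasEdge {y} Axy =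
    x , y , Equivalence.from ∈-componentOf here , Equivalence.from ∈-componentOf (step here Axy) , Axy

module Components {d} (G : Graph d) (G-sym : Symmetric G) {m} (C : Fin m → Vec Bool d)
  (C-component : ∀ j → IsComponent (compl G) (C j))
  (C-injective : ∀ j k → C j ≡ C k → j ≡ k)
  (C-covers : ∀ x y → compl G x y ≡ true → ∃ λ j → x ∈ₛ C j) where

  Ḡ : Graph d
  Ḡ = compl G

  H : Fin m → Graph d
  H j = KminusComp G (C j)

  HEdge : Fin m → Fin d → Fin d → Set
  HEdge j x y = Ḡ x y ≡ true × x ∈ₛ C j

  Ḡ? : ∀ x y → Dec (Ḡ x y ≡ true)
  Ḡ? x y = Ḡ x y Bool.≟ true

  HEdge? : ∀ j x y → Dec (HEdge j x y)
  HEdge? j x y = Ḡ? x y ×-dec (Vec.lookup (C j) x Bool.≟ true)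

  ∈-closed : ∀ {j x y} → x ∈ₛ C j → Ḡ x y ≡ true → y ∈ₛ C j
  ∈-closed {j} {x} {y} x∈C Ḡxy = proj₂ (proj₂ (C-component j) x y x∈C) (step here Ḡxy)

  ∈-unique : ∀ {j k x} → x ∈ₛ C j → x ∈ₛ C k → j ≡ k
  ∈-unique {j} {k} {x} x∈Cj x∈Ck =
    C-injective j k (Pointwise-≡⇒≡ (ext λ y → ⇔→≡ (mk⇔ (via x∈Cj x∈Ck) (via x∈Ck x∈Cj))))
    where
    via : ∀ {j k y} → x ∈ₛ C j → x ∈ₛ C k → y ∈ₛ C j → y ∈ₛ C k
    via {j} {k} {y} x∈Cj x∈Ck y∈Cj =
      proj₂ (proj₂ (C-component k) x y x∈Ck) (proj₁ (proj₂ (C-component j) x y x∈Cj) y∈Cj)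

  HEdge-∈ : ∀ {j x y z} → HEdge j x y → z ∈ₑ (x , y) → z ∈ₛ C j
  HEdge-∈ (_   , x∈C) (inj₁ refl) = x∈C
  HEdge-∈ (Ḡxy , x∈C) (inj₂ refl) = ∈-closed x∈C Ḡxy

  HEdge-at : ∀ {j x y z} → Ḡ x y ≡ true → z ∈ₑ (x , y) → z ∈ₛ C j → HEdge j x y
  HEdge-at {x = x} {y} Ḡxy (inj₁ refl) z∈C = Ḡxy , z∈C
  HEdge-at {x = x} {y} Ḡxy (inj₂ refl) z∈C = Ḡxy , ∈-closed z∈C (trans (compl-sym G-sym y x) Ḡxy)

  HEdge-sym : ∀ {j x y} → HEdge j x y → HEdge j y x
  HEdge-sym {x = x} {y} h@(Ḡxy , _) = trans (compl-sym G-sym y x) Ḡxy , HEdge-∈ h (inj₂ refl)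

  HEdge-cover : ∀ {x y} → Ḡ x y ≡ true → ∃ λ j → HEdge j x y
  HEdge-cover {x} {y} Ḡxy = proj₁ (C-covers x y Ḡxy) , Ḡxy , proj₂ (C-covers x y Ḡxy)

  H-minus-HEdge : ∀ j → IsCompleteMinus (H j) (HEdge j)
  H-minus-HEdge j {x} {y} x≢y = lemma (K d x y) (Ḡ x y) (Vec.lookup (C j) x) (K-≢ x≢y)
    where
    lemma : ∀ k g c → k ≡ true → (k ∧ not (g ∧ c)) ≡ true ⇔ (¬ (g ≡ true × c ≡ true))
    lemma true true  true  refl = mk⇔ (λ ()) (λ ¬both → ⊥-elim (¬both (refl , refl)))
    lemma true true  false refl = mk⇔ (λ _ ()) (λ _ → refl)
    lemma true false _     refl = mk⇔ (λ _ ()) (λ _ → refl)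

  H-sym : ∀ j → Symmetric (H j)
  H-sym j = completeMinus-sym (H-minus-HEdge j) HEdge-sym

  HEdge-meet : ∀ {j k x y u v z} → HEdge j x y → HEdge k u v → z ∈ₑ (x , y) → z ∈ₑ (u , v) → j ≡ k
  HEdge-meet hj hk z∈xy z∈uv = ∈-unique (HEdge-∈ hj z∈xy) (HEdge-∈ hk z∈uv)

  cover-either : ∀ {x y u v} → Ḡ x y ≡ true ⊎ Ḡ u v ≡ true → ∃ λ j → HEdge j x y ⊎ HEdge j u v
  cover-either (inj₁ Ḡxy) = Product.map₂ inj₁ (HEdge-cover Ḡxy)
  cover-either (inj₂ Ḡuv) = Product.map₂ inj₂ (HEdge-cover Ḡuv)

  crosses-meet : ∀ {j k a b c e} → HEdge j a c ⊎ HEdge j b e → HEdge k a e ⊎ HEdge k b c → j ≡ k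
  crosses-meet (inj₁ ac) (inj₁ ae) = HEdge-meet ac ae (inj₁ refl) (inj₁ refl)
  crosses-meet (inj₁ ac) (inj₂ bc) = HEdge-meet ac bc (inj₂ refl) (inj₂ refl)
  crosses-meet (inj₂ be) (inj₁ ae) = HEdge-meet be ae (inj₂ refl) (inj₂ refl)
  crosses-meet (inj₂ be) (inj₂ bc) = HEdge-meet be bc (inj₁ refl) (inj₁ refl)

  module _ {a b c e : Fin d} (a<b : Ordered (a , b)) (c<e : Ordered (c , e)) (lex : LexLt (a , b) (c , e)) where

    private
      t = (a , b) , (c , e)

    pointwise-identity-share : Share (a , b) (c , e) →
      χ (K d) t - χ G t ≡ ∑[ j < m ] (χ (K d) t - χ (H j) t)
    pointwise-identity-share share = begin
      χ (K d) t - χ G t                                  ≡⟨ cong (_- χ G t) χK≡1 ⟩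
      1ℤ - χ G t                                         ≡⟨ 1-𝟙≡𝟙-¬ _ ⟩
      𝟙 (¬? (isCombinatorialEdge? G t))                  ≡⟨ 𝟙≡∑𝟙 m _ _ G-defect⇒H-defect H-defect⇒G-defect
                                                                    H-defect-unique ⟩
      ∑[ j < m ] 𝟙 (¬? (isCombinatorialEdge? (H j) t))   ≡⟨ sum-cong-≗ (λ j → trans (sym (1-𝟙≡𝟙-¬ _))
                                                                    (cong (_- χ (H j) t) (sym χK≡1))) ⟩
      ∑[ j < m ] (χ (K d) t - χ (H j) t)                 ∎
      where
      ¬comb⇔ : ∀ {A R} (R? : ∀ x y → Dec (R x y)) → IsCompleteMinus A R →
        (¬ IsCombinatorialEdge A t) ⇔ (R a b ⊎ R c e)
      ¬comb⇔ R? A≈ = ¬combinatorialEdge⇔-share R? A≈ a<b c<e lex share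
      χK≡1 : χ (K d) t ≡ 1ℤ
      χK≡1 = 𝟙-yes _ (decidable-stable (isCombinatorialEdge? (K d) t)
        (Sum.[ id , id ]′ ∘ Equivalence.to (¬comb⇔ (λ _ _ → no id) K-minus-⊥)))
      G-defect⇒H-defect : ¬ IsCombinatorialEdge G t → ∃ λ j → ¬ IsCombinatorialEdge (H j) t
      G-defect⇒H-defect = Product.map₂ (Equivalence.from (¬comb⇔ (HEdge? _) (H-minus-HEdge _)))
        ∘ cover-either ∘ Equivalence.to (¬comb⇔ Ḡ? (minus-compl G))
      H-defect⇒G-defect : ∀ j → ¬ IsCombinatorialEdge (H j) t → ¬ IsCombinatorialEdge G t
      H-defect⇒G-defect j = Equivalence.from (¬comb⇔ Ḡ? (minus-compl G))
        ∘ Sum.map proj₁ proj₁ ∘ Equivalence.to (¬comb⇔ (HEdge? j) (H-minus-HEdge j))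
      H-defect-unique : ∀ j k → ¬ IsCombinatorialEdge (H j) t → ¬ IsCombinatorialEdge (H k) t → j ≡ k
      H-defect-unique j k ¬Hj ¬Hk = ∈-unique (touch (to ¬Hj)) (touch (to ¬Hk))
        where
        to = λ {j} → Equivalence.to (¬comb⇔ (HEdge? j) (H-minus-HEdge j))
        common = shared-endpoint share
        touch : ∀ {j} → HEdge j a b ⊎ HEdge j c e → proj₁ common ∈ₛ C j
        touch = Sum.[ (λ ab → HEdge-∈ ab (proj₁ (proj₂ common)))
                    , (λ ce → HEdge-∈ ce (proj₂ (proj₂ common))) ]′

    pointwise-identity-disjoint : ¬ Share (a , b) (c , e) →
      χ (K d) t - χ G t ≡ ∑[ j < m ] (χ (K d) t - χ (H j) t)
    pointwise-identity-disjoint ¬share = begin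
      χ (K d) t - χ G t                    ≡⟨ cong₂ _-_ χK≡0 (𝟙≡∑𝟙 m _ _ G-face⇒H-face H-face⇒G-face
                                                                       H-face-unique) ⟩
      0ℤ - ∑[ j < m ] χ (H j) t            ≡⟨ cong (_- ∑[ j < m ] χ (H j) t) (sum-replicate-zero m) ⟨
      ∑[ j < m ] 0ℤ - ∑[ j < m ] χ (H j) t ≡⟨ ∑-distrib-- m (λ _ → 0ℤ) (λ j → χ (H j) t) ⟨
      ∑[ j < m ] (0ℤ - χ (H j) t)          ≡⟨ sum-cong-≗ (λ j → cong (_- χ (H j) t) (sym χK≡0)) ⟩
      ∑[ j < m ] (χ (K d) t - χ (H j) t)   ∎
      where
      comb⇔ : ∀ {A R} (R? : ∀ x y → Dec (R x y)) → IsCompleteMinus A R →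
        IsCombinatorialEdge A t ⇔ (¬ R a b × ¬ R c e × (R a c ⊎ R b e) × (R a e ⊎ R b c))
      comb⇔ R? A≈ = combinatorialEdge⇔-disjoint R? A≈ a<b c<e lex ¬share
      χK≡0 : χ (K d) t ≡ 0ℤ
      χK≡0 = 𝟙-no _ λ K-face → case Equivalence.to (comb⇔ (λ _ _ → no id) K-minus-⊥) K-face of λ
        { (_ , _ , ac⊎be , _) → Sum.[ id , id ]′ ac⊎be }
      G-face⇒H-face : IsCombinatorialEdge G t → ∃ λ j → IsCombinatorialEdge (H j) t
      G-face⇒H-face G-face with Equivalence.to (comb⇔ Ḡ? (minus-compl G)) G-face
      ... | ¬Ḡab , ¬Ḡce , Ḡac⊎Ḡbe , Ḡae⊎Ḡbc with cover-either Ḡac⊎Ḡbe | cover-either Ḡae⊎Ḡbc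
      ... | j , cross₁ | k , cross₂ = j , Equivalence.from (comb⇔ (HEdge? j) (H-minus-HEdge j))
        (¬Ḡab ∘ proj₁ , ¬Ḡce ∘ proj₁ , cross₁ ,
         subst (λ i → HEdge i a e ⊎ HEdge i b c) (sym (crosses-meet cross₁ cross₂)) cross₂)
      H-face⇒G-face : ∀ j → IsCombinatorialEdge (H j) t → IsCombinatorialEdge G t
      H-face⇒G-face j H-face with Equivalence.to (comb⇔ (HEdge? j) (H-minus-HEdge j)) H-face
      ... | ¬hab , ¬hce , cross₁ , cross₂ = Equivalence.from (comb⇔ Ḡ? (minus-compl G))
        (¬Ḡab , ¬Ḡce , Sum.map proj₁ proj₁ cross₁ , Sum.map proj₁ proj₁ cross₂)
        where
        ¬Ḡab : ¬ Ḡ a b ≡ true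
        ¬Ḡab Ḡab = ¬hab (Sum.[ (λ ac → HEdge-at Ḡab (inj₁ refl) (HEdge-∈ ac (inj₁ refl)))
                             , (λ be → HEdge-at Ḡab (inj₂ refl) (HEdge-∈ be (inj₁ refl))) ]′ cross₁)
        ¬Ḡce : ¬ Ḡ c e ≡ true
        ¬Ḡce Ḡce = ¬hce (Sum.[ (λ ac → HEdge-at Ḡce (inj₁ refl) (HEdge-∈ ac (inj₂ refl)))
                             , (λ be → HEdge-at Ḡce (inj₂ refl) (HEdge-∈ be (inj₂ refl))) ]′ cross₁)
      H-face-unique : ∀ j k → IsCombinatorialEdge (H j) t → IsCombinatorialEdge (H k) t → j ≡ k
      H-face-unique j k Hj-face Hk-face
        with Equivalence.to (comb⇔ (HEdge? j) (H-minus-HEdge j)) Hj-face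
           | Equivalence.to (comb⇔ (HEdge? k) (H-minus-HEdge k)) Hk-face
      ... | _ , _ , cross₁ , _ | _ , _ , _ , cross₂ = crosses-meet cross₁ cross₂

  pointwise-identity : ∀ t → χ (K d) t - χ G t ≡ ∑[ j < m ] (χ (K d) t - χ (H j) t)
  pointwise-identity t@((a , b) , (c , e))
    with toSum ((toℕ a ℕP.<? toℕ b) ×-dec (toℕ c ℕP.<? toℕ e) ×-dec lexLt? (a , b) (c , e))
  ... | inj₁ (a<b , c<e , lex) =
    Sum.[ pointwise-identity-share a<b c<e lex , pointwise-identity-disjoint a<b c<e lex ]′
      (toSum (share? (a , b) (c , e)))
  ... | inj₂ ¬candidate =
    trans (cong₂ _-_ (χ≡0 (K d)) (χ≡0 G)) (sym (∑-zero m _ (λ j → cong₂ _-_ (χ≡0 (K d)) (χ≡0 (H j)))))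
    where
    χ≡0 : ∀ A → χ A t ≡ 0ℤ
    χ≡0 A = 𝟙-no _ λ ((a<b , _) , (c<e , _) , lex , _) → ¬candidate (a<b , c<e , lex)

  ε-identity : ∀ {εK εG} {εH : Fin m → ℕ} → εIs (K d) εK → εIs G εG → (∀ j → εIs (H j) (εH j)) →
    + εK - + εG ≡ ∑[ j < m ] (+ εK - + εH j)
  ε-identity {εK} {εG} {εH} εK-is εG-is εH-is = begin
    + εK - + εG                                    ≡⟨ cong₂ _-_ (ε≡∑χ K-sym εK-is) (ε≡∑χ G-sym εG-is) ⟩
    ∑ₗ Q (χ (K d)) - ∑ₗ Q (χ G)                    ≡⟨ ∑ₗ-distrib-- (χ (K d)) (χ G) ⟨
    ∑ₗ Q (λ t → χ (K d) t - χ G t)                 ≡⟨ sum-cong-≗ (pointwise-identity ∘ lookup Q) ⟩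
    ∑ₗ Q (λ t → ∑[ j < m ] (χ (K d) t - χ (H j) t)) ≡⟨ ∑-comm (λ k j → χ (K d) (lookup Q k) - χ (H j) (lookup Q k)) ⟩
    ∑[ j < m ] ∑ₗ Q (λ t → χ (K d) t - χ (H j) t)  ≡⟨ sum-cong-≗ (λ j → ∑ₗ-distrib-- (χ (K d)) (χ (H j))) ⟩
    ∑[ j < m ] (∑ₗ Q (χ (K d)) - ∑ₗ Q (χ (H j)))   ≡⟨ sum-cong-≗ (λ j → cong₂ _-_ (ε≡∑χ K-sym εK-is)
                                                                               (ε≡∑χ (H-sym j) (εH-is j))) ⟨
    ∑[ j < m ] (+ εK - + εH j)                     ∎
    where
    Q = quadruples d
    ∑ₗ-distrib-- : ∀ f g → ∑ₗ Q (λ t → f t - g t) ≡ ∑ₗ Q f - ∑ₗ Q g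
    ∑ₗ-distrib-- f g = ∑-distrib-- (length Q) (f ∘ lookup Q) (g ∘ lookup Q)

listed-components-cover : ∀ {d} {A : Graph d} → Symmetric A → ∀ {m} {C : Fin m → Vec Bool d} →
  (∀ D → IsComponent A D → HasEdge A D → ∃ λ j → C j ≡ D) → (∀ x y → Dec (Reach A x y)) →
  ∀ x y → A x y ≡ true → ∃ λ j → x ∈ₛ C j
listed-components-cover A-sym C-complete reach? x y Axy
  with C-complete (componentOf (reach? x)) (componentOf-isComponent (reach? x) A-sym)
                  (componentOf-hasEdge (reach? x) Axy)
... | j , Cj≡D = j , subst (x ∈ₛ_) (sym Cj≡D) (Equivalence.from (∈-componentOf (reach? x)) here)

¬¬-∀ : ∀ {n} {P : Fin n → Set} → (∀ i → ¬ ¬ P i) → ¬ ¬ (∀ i → P i)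
¬¬-∀ {zero}  ¬¬P ¬∀ = ¬∀ λ ()
¬¬-∀ {suc n} ¬¬P ¬∀ =
  ¬¬P fzero λ P0 → ¬¬-∀ (¬¬P ∘ fsuc) λ P-rest → ¬∀ λ { fzero → P0 ; (fsuc i) → P-rest i }

proposition1p4 : (d : ℕ) → 3 ≤ d → (G : Graph d) → IsSimple G →
  (m : ℕ) → (C : Fin m → Vec Bool d) →
  (∀ j → IsComponent (compl G) (C j) × HasEdge (compl G) (C j)) →
  (∀ j k → C j ≡ C k → j ≡ k) →
  (∀ D → IsComponent (compl G) D → HasEdge (compl G) D → ∃ λ j → C j ≡ D) →
  (εK εG : ℕ) → (εH : Fin m → ℕ) →
  εIs (K d) εK → εIs G εG → (∀ j → εIs (KminusComp G (C j)) (εH j)) →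
  (+ εK) - (+ εG) ≡ sumℤ m (λ j → (+ εK) - (+ εH j))
-- Reachability in Ḡ is used only to build the
-- vertex vector of a component; as the goal is a decidable equation, it may be assumed
-- decidable under a double negation.
proposition1p4 d _ G (G-sym , _) m C C-components C-injective C-complete εK εG εH εK-is εG-is εH-is =
  decidable-stable (_ ℤ.≟ _) λ identity-fails →
    ¬¬-∀ (λ x → ¬¬-∀ λ y → ¬¬-excluded-middle) λ reach? →
      identity-fails (trans
        (Components.ε-identity G G-sym C (proj₁ ∘ C-components) C-injective
           (listed-components-cover (compl-sym G-sym) C-complete reach?) εK-is εG-is εH-is)
        (sym (sumℤ≡∑ m _)))
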